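{- Let $R=\mathrm{GR}(4,m)$, let $n$ be odd, let $\alpha\in R$ be a primitive $2n$th root of unity with $\alpha^n=-1$, let $t,r\ge 1$, and let $C=\{c\in\mathbb{Z}_4^n : c(\alpha^k)=0 \text{ for } k=1,3,\dots,2t-1\}$. Assume $C$ has minimum Lee distance at least $2r+1$. Let $B(0,r)=\{e\in\mathbb{Z}_4^n: w(e)\le r\}$ and let $\Lambda:B(0,r)\to R[z]$ map $e$ to its error locator polynomial $\sigma$. Then the map $f:\Lambda(B(0,r))\to R^t$, $\sigma\mapsto(T_1,\dots,T_t)$, is injective.
   Context: Vectors $v=(v_0,\dots,v_{n-1})\in\mathbb{Z}_4^n$ are identified with polynomials $v(z)=\sum v_iz^i$, and $v(\alpha^k)$ is evaluated in $R$. Lee weight: $w(0)=0$, $w(1)=w(3)=1$, $w(2)=2$, extended additively; minimum Lee distance of $C$ is the minimum Lee weight of a nonzero element of $C$. For $e\in\mathbb{Z}_4^n$ put $X_i=0$ if $e_i=0$, $X_i=\alpha^i$ if $e_i\in\{1,2\}$, $X_i=-\alpha^i$ if $e_i=3$, and define the error locator polynomial $\sigma=\prod_{i=0}^{n-1}(1-X_iz)^{w(e_i)}\in R[z]$. For a power series $P=\sum_k P_kz^k\in R[[z]]$ write $P_{\mathrm{even}}=\sum_j P_{2j}z^{2j}$ and $P_{\mathrm{odd}}=\sum_j P_{2j+1}z^{2j+1}$. Given $\sigma$, let $u=\sigma_{\mathrm{odd}}/\sigma_{\mathrm{even}}\in R[[z]]$ (note $\sigma_{\mathrm{even}}(0)=1$),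 and define the power series $T=\sum_{k\ge1}T_kz^k$ by $T(z^2)=(1+zu(z))^{ -1}-1$; then $f(\sigma)=(T_1,\dots,T_t)$. -}

module Defs where

open import Data.Nat using (ℕ; zero; suc; _+_; _*_; _∸_; _≤_; _<_; _≡ᵇ_)
open import Data.Bool using (Bool; true; false; _xor_; _∧_; if_then_else_)
open import Data.List using (List; []; _∷_; _++_; [_])
open import Data.Vec using (Vec; []; _∷_; replicate; zipWith; map; toList)
open import Data.Product using (_×_; _,_)
open import Relation.Binary.PropositionalEquality using (_≡_)
open import Data.Empty using (⊥)

data Z4 : Set where
  z0 z1 z2 z3 : Z4

toN : Z4 → ℕ
toN z0 = 0
toN z1 = 1
toN z2 = 2
toN z3 = 3

fromN : ℕ → Z4
fromN zero = z0
fromN (suc zero) = z1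
fromN (suc (suc zero)) = z2
fromN (suc (suc (suc zero))) = z3
fromN (suc (suc (suc (suc k)))) = fromN k

infixl 6 _+₄_
infixl 7 _*₄_

_+₄_ : Z4 → Z4 → Z4
a +₄ b = fromN (toN a + toN b)

_*₄_ : Z4 → Z4 → Z4
a *₄ b = fromN (toN a * toN b)

-₄_ : Z4 → Z4
-₄ a = fromN (4 ∸ toN a)

mod2 : Z4 → Bool
mod2 z0 = false
mod2 z1 = true
mod2 z2 = false
mod2 z3 = true

leeW : Z4 → ℕ
leeW z0 = 0
leeW z1 = 1
leeW z2 = 2
leeW z3 = 1

leeWeight : ∀ {n} → Vec Z4 n → ℕ
leeWeight [] = 0
leeWeight (x ∷ xs) = leeW x + leeWeight xs

-- Binary polynomials as coefficient lists (lowest degree first)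

addB : List Bool → List Bool → List Bool
addB [] g = g
addB (a ∷ f) [] = a ∷ f
addB (a ∷ f) (b ∷ g) = (a xor b) ∷ addB f g

mulB : List Bool → List Bool → List Bool
mulB [] g = []
mulB (a ∷ f) g = addB (Data.List.map (a ∧_) g) (false ∷ mulB f g)

-- A monic polynomial h = x^m + h_{m-1} x^{m-1} + ... + h_0 over Z4 is
-- given by its lower coefficient vector (h_0, ..., h_{m-1}).
-- Its reduction mod 2 (as a full coefficient list):
monicBar : ∀ {m} → Vec Z4 m → List Bool
monicBar h = toList (map mod2 h) ++ [ true ]

monicB : ∀ {d} → Vec Bool d → List Bool
monicB f = toList f ++ [ true ]

-- h is basic irreducible: m ≥ 1 and h mod 2 is irreducible over F₂,
-- i.e. it is not a product of two (monic = nonzero) binary polynomials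
-- of positive degree.
BasicIrreducible : (m : ℕ) → Vec Z4 m → Set
BasicIrreducible m h =
  (1 ≤ m) ×
  (∀ (d₁ d₂ : ℕ) (f : Vec Bool d₁) (g : Vec Bool d₂) → 1 ≤ d₁ → 1 ≤ d₂ →
     mulB (monicB f) (monicB g) ≡ monicBar h → ⊥)

-- The Galois ring GR(4,m) = Z₄[x]/(h(x)), elements are coefficient
-- vectors of length m (residues of degree < m).

module GR (m : ℕ) (h : Vec Z4 m) where

  R : Set
  R = Vec Z4 m

  embed : ∀ {k} → Z4 → Vec Z4 k
  embed {zero} c = []
  embed {suc k} c = c ∷ replicate k z0

  0R : R
  0R = replicate m z0

  1R : R
  1R = embed z1

  infixl 6 _+R_
  infixl 7 _*R_ _·_

  _+R_ : R → R → R
  _+R_ = zipWith _+₄_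

  -R_ : R → R
  -R_ = map -₄_

  _-R_ : R → R → R
  a -R b = a +R (-R b)

  _·_ : Z4 → R → R
  c · a = map (c *₄_) a

  -- push everything one degree up; returns the new vector and the
  -- coefficient pushed out at degree m
  shiftUp : ∀ {k} → Vec Z4 k → Z4 → Vec Z4 k × Z4
  shiftUp [] c = [] , c
  shiftUp (x ∷ xs) c with shiftUp xs x
  ... | ys , top = (c ∷ ys) , top

  -- multiplication by x modulo h (x^m = - (h_0 + ... + h_{m-1}x^{m-1}))
  xmul : R → R
  xmul a with shiftUp a z0
  ... | s , top = s -R (top · h)

  mulAux : ∀ {k} → Vec Z4 k → R → R
  mulAux [] b = 0R
  mulAux (c ∷ cs) b = (c · b) +R xmul (mulAux cs b)

  _*R_ : R → R → R
  a *R b = mulAux a b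

  _^R_ : R → ℕ → R
  a ^R zero = 1R
  a ^R suc k = a *R (a ^R k)

  evalAt : ∀ {k} → Vec Z4 k → R → R
  evalAt [] x = 0R
  evalAt (c ∷ cs) x = embed c +R (x *R evalAt cs x)

  -- power series over R as coefficient functions ℕ → R
  -- (a polynomial in R[z] is a power series with finitely many nonzero
  --  coefficients; equality is coefficientwise)

  Series : Set
  Series = ℕ → R

  sumUpTo : ℕ → (ℕ → R) → R
  sumUpTo zero f = f 0
  sumUpTo (suc k) f = sumUpTo k f +R f (suc k)

  mulS : Series → Series → Series
  mulS a b k = sumUpTo k (λ i → a i *R b (k ∸ i))

  oneS : Series
  oneS zero = 1R
  oneS (suc k) = 0R

  powS : Series → ℕ → Series
  powS a zero = oneS
  powS a (suc k) = mulS a (powS a k)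

  -- inverse of a power series with constant term 1:
  -- b_0 = 1, b_k = - Σ_{i=1}^{k} a_i b_{k-i}.
  -- invRev a k = [b_{k-1}, ..., b_0]
  dotS : Series → List R → ℕ → R
  dotS a [] off = 0R
  dotS a (x ∷ L) off = (a (suc off) *R x) +R dotS a L (suc off)

  invRev : Series → ℕ → List R
  invRev a zero = []
  invRev a (suc k) = nxt ∷ L
    where
      L = invRev a k
      nxt = (if k ≡ᵇ 0 then 1R else 0R) -R dotS a L 0

  headOr0 : List R → R
  headOr0 [] = 0R
  headOr0 (x ∷ _) = x

  invS : Series → Series
  invS a k = headOr0 (invRev a (suc k))

  isEven : ℕ → Bool
  isEven zero = true
  isEven (suc zero) = false
  isEven (suc (suc k)) = isEven k

  evenS : Series → Series
  evenS a k = if isEven k then a k else 0R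

  oddS : Series → Series
  oddS a k = if isEven k then 0R else a k

  zS : Series → Series
  zS a zero = 0R
  zS a (suc k) = a k

  addS : Series → Series → Series
  addS a b k = a k +R b k

  Xval : R → ℕ → Z4 → R
  Xval α i z0 = 0R
  Xval α i z1 = α ^R i
  Xval α i z2 = α ^R i
  Xval α i z3 = -R (α ^R i)

  oneMinus : R → Series
  oneMinus X zero = 1R
  oneMinus X (suc zero) = -R X
  oneMinus X (suc (suc k)) = 0R

  locFrom : R → ℕ → ∀ {k} → Vec Z4 k → Series
  locFrom α i [] = oneS
  locFrom α i (e ∷ es) =
    mulS (powS (oneMinus (Xval α i e)) (leeW e)) (locFrom α (suc i) es)

  locator : R → ∀ {n} → Vec Z4 n → Series
  locator α e = locFrom α 0 e

  -- the map f : σ ↦ (T_1, ..., T_t)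
  -- u = σ_odd / σ_even,  T(z²) = (1 + z u)^{-1} - 1, so T_k is the
  -- coefficient of z^{2k} of (1 + z u)^{-1} for k ≥ 1.

  uS : Series → Series
  uS σ = mulS (oddS σ) (invS (evenS σ))

  Tcoef : Series → ℕ → R
  Tcoef σ k = invS (addS oneS (zS (uS σ))) (2 * k)

module Submission where

-- Let e, e′ be errors of Lee weight ≤ r with locators σ, σ′.
-- Both have constant term 1.  Write σ = E + O (even and odd parts), so that
-- u = O/E and W = (1 + z u)⁻¹ has coefficients W_{2k} = T_k.  If σ and σ′
-- have the same T_1 … T_t, then W and W′ agree below degree 2t + 1, hence so
-- do their inverses 1 + z u, 1 + z u′, and u, u′ agree below degree 2t.
-- Expanding (E + O)(E′ - O′) with O = uE, O′ = u′E′ shows that the twisted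
-- product P(z) = σ(z) σ′(-z) has no odd coefficients below degree 2t.  The
-- logarithmic derivative M = P′/P = ℓ(z) + ℓ′(-z) of the even-below-2t
-- series P is again even below 2t, and the odd coefficients ℓ_k of the
-- logarithmic derivative of a locator are (minus) the syndromes e(α^k).
-- Thus e and e′ have the same syndromes at α, α³, …, α^{2t-1}, so e - e′ is
-- a codeword of Lee weight ≤ 2r, hence zero: e = e′ and σ = σ′.

open import Defs
open import Level using (0ℓ)
open import Data.Nat as ℕ using (ℕ; zero; suc; _∸_; _≤_; _<_; z≤n; s≤s)
open import Data.Nat.Properties as ℕₚ
  using (≤-refl; ≤-trans; <-≤-trans; ≤-<-trans; m<1+n⇒m<n∨m≡n; m≤n⇒m≤1+n; n≤1+n; m∸n≤m; m+[n∸m]≡n; m∸[m∸n]≡n; ∸-+-assoc; +-∸-assoc; n∸n≡0; +-suc)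
open import Data.Bool using (Bool; true; false; not; _xor_)
open import Data.Bool.Properties using (not-involutive; not-distribˡ-xor; xor-same)
open import Data.Sum using (inj₁; inj₂)
open import Data.Vec using (Vec; []; _∷_; replicate; zipWith; map)
open import Data.Vec.Properties using (≡-dec; ∷-injectiveˡ; ∷-injectiveʳ; zipWith-assoc; zipWith-comm; zipWith-identityˡ; zipWith-inverseʳ; map-∘; map-cong; map-id; map-replicate)
open import Data.Product using (_×_; _,_; proj₁; proj₂; ∃)
open import Data.Empty using (⊥-elim)
open import Relation.Binary.PropositionalEquality
  using (_≡_; _≢_; refl; sym; trans; cong; cong₂; isEquivalence; module ≡-Reasoning)
open import Relation.Binary.Definitions using (DecidableEquality)
open import Relation.Binary.Structures using (IsEquivalence)
open import Relation.Nullary.Decidable using (Dec; yes; no; map′; _×-dec_; _→-dec_; from-yes)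
open import Algebra.Bundles using (CommutativeRing)

-- A commutative ring from its one-sided axioms (the other sides follow by
-- commutativity).
mkCommutativeRing : (A : Set) (_≈_ : A → A → Set) → IsEquivalence _≈_ →
  (_+_ _*_ : A → A → A) (-_ : A → A) (0# 1# : A) →
  (∀ {x y u v} → x ≈ y → u ≈ v → (x + u) ≈ (y + v)) →
  (∀ {x y u v} → x ≈ y → u ≈ v → (x * u) ≈ (y * v)) →
  (∀ {x y} → x ≈ y → (- x) ≈ (- y)) →
  (∀ x y z → ((x + y) + z) ≈ (x + (y + z))) →
  (∀ x y → (x + y) ≈ (y + x)) →
  (∀ x → (0# + x) ≈ x) →
  (∀ x → (x + (- x)) ≈ 0#) →
  (∀ x y z → ((x * y) * z) ≈ (x * (y * z))) →
  (∀ x y → (x * y) ≈ (y * x)) →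
  (∀ x → (1# * x) ≈ x) →
  (∀ x y z → (x * (y + z)) ≈ ((x * y) + (x * z))) →
  CommutativeRing 0ℓ 0ℓ
mkCommutativeRing A _≈_ eq _+_ _*_ -_ 0# 1# +-cong *-cong -‿cong +-assoc +-comm +-idˡ -‿invʳ *-assoc *-comm *-idˡ distribˡ =
  record
    { Carrier = A ; _≈_ = _≈_ ; _+_ = _+_ ; _*_ = _*_ ; -_ = -_ ; 0# = 0# ; 1# = 1#
    ; isCommutativeRing = record
      { isRing = record
        { +-isAbelianGroup = record
          { isGroup = record
            { isMonoid = record
              { isSemigroup = record
                { isMagma = record { isEquivalence = eq ; ∙-cong = +-cong } ; assoc = +-assoc }
              ; identity = +-idˡ , λ x → ≈-trans (+-comm x 0#) (+-idˡ x) }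
            ; inverse = (λ x → ≈-trans (+-comm (- x) x) (-‿invʳ x)) , -‿invʳ
            ; ⁻¹-cong = -‿cong }
          ; comm = +-comm }
        ; *-cong = *-cong
        ; *-assoc = *-assoc
        ; *-identity = *-idˡ , λ x → ≈-trans (*-comm x 1#) (*-idˡ x)
        ; distrib = distribˡ , λ x y z →
            ≈-trans (*-comm (y + z) x) (≈-trans (distribˡ x y z) (+-cong (*-comm x y) (*-comm x z))) }
      ; *-comm = *-comm } }
  where open IsEquivalence eq using () renaming (trans to ≈-trans)

module RingIdentities (CR : CommutativeRing 0ℓ 0ℓ) where
  open CommutativeRing CR renaming (refl to ≈-refl; sym to ≈-sym; trans to ≈-trans)
  open import Algebra.Properties.Ring ring using (-‿distribʳ-*)
  open import Algebra.Properties.CommutativeSemigroup +-commutativeSemigroup using (interchange)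
  open import Relation.Binary.Reasoning.Setoid setoid

  unit-solve : ∀ {x y m d} → x * y ≈ 1# → x * m ≈ d → m ≈ y * d
  unit-solve {x} {y} {m} {d} xy xm = begin
    m             ≈⟨ ≈-sym (*-identityʳ m) ⟩
    m * 1#        ≈⟨ *-congˡ (≈-sym xy) ⟩
    m * (x * y)   ≈⟨ ≈-sym (*-assoc m x y) ⟩
    (m * x) * y   ≈⟨ *-congʳ (≈-trans (*-comm m x) xm) ⟩
    d * y         ≈⟨ *-comm d y ⟩
    y * d         ∎

  unit-cancel : ∀ {x y} z → x * y ≈ 1# → (z * y) * x ≈ z
  unit-cancel {x} {y} z xy = begin
    (z * y) * x   ≈⟨ *-assoc z y x ⟩
    z * (y * x)   ≈⟨ *-congˡ (≈-trans (*-comm y x) xy) ⟩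
    z * 1#        ≈⟨ *-identityʳ z ⟩
    z             ∎

  -- Product rule for logarithmic derivatives: a′ = a l and b′ = b r give
  -- a′ b + a b′ = (a b)(l + r).
  log-product : ∀ a l b r → (a * l) * b + a * (b * r) ≈ (a * b) * (l + r)
  log-product a l b r = begin
    (a * l) * b + a * (b * r)  ≈⟨ +-cong (≈-trans (*-assoc a l b) (*-congˡ (*-comm l b))) (≈-sym (*-assoc a b r)) ⟩
    a * (b * l) + (a * b) * r  ≈⟨ +-congʳ (≈-sym (*-assoc a b l)) ⟩
    (a * b) * l + (a * b) * r  ≈⟨ ≈-sym (distribˡ (a * b) l r) ⟩
    (a * b) * (l + r)          ∎

  twisted-product : ∀ {e o e′ o′} u u′ → o ≈ u * e → o′ ≈ u′ * e′ →
    (e + o) * (e′ + - o′) ≈ (e * e′ + - (o * o′)) + (u * (e * e′) + - (u′ * (e * e′)))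
  twisted-product {e} {o} {e′} {o′} u u′ o≈ o′≈ = begin
    (e + o) * (e′ + - o′)
      ≈⟨ distribʳ (e′ + - o′) e o ⟩
    e * (e′ + - o′) + o * (e′ + - o′)
      ≈⟨ +-cong (distribˡ e e′ (- o′)) (distribˡ o e′ (- o′)) ⟩
    (e * e′ + e * - o′) + (o * e′ + o * - o′)
      ≈⟨ +-cong (+-congˡ (≈-sym (-‿distribʳ-* e o′))) (+-congˡ (≈-sym (-‿distribʳ-* o o′))) ⟩
    (e * e′ + - (e * o′)) + (o * e′ + - (o * o′))
      ≈⟨ interchange _ _ _ _ ⟩
    (e * e′ + o * e′) + (- (e * o′) + - (o * o′))
      ≈⟨ +-congˡ (+-comm _ _) ⟩
    (e * e′ + o * e′) + (- (o * o′) + - (e * o′))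
      ≈⟨ interchange _ _ _ _ ⟩
    (e * e′ + - (o * o′)) + (o * e′ + - (e * o′))
      ≈⟨ +-congˡ (+-cong ue′ (-‿cong eu′)) ⟩
    (e * e′ + - (o * o′)) + (u * (e * e′) + - (u′ * (e * e′))) ∎
    where
      ue′ : o * e′ ≈ u * (e * e′)
      ue′ = ≈-trans (*-congʳ o≈) (*-assoc u e e′)
      eu′ : e * o′ ≈ u′ * (e * e′)
      eu′ = ≈-trans (*-congˡ o′≈) (≈-trans (≈-sym (*-assoc e u′ e′))
              (≈-trans (*-congʳ (*-comm e u′)) (*-assoc u′ e e′)))

-- Arithmetic of ℕ is brought into scope only now, as RingIdentities uses
-- + and * for the ring operations.
open import Data.Nat using (_+_; _*_; _%_)

fromN-toN : ∀ a → fromN (toN a) ≡ a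
fromN-toN z0 = refl
fromN-toN z1 = refl
fromN-toN z2 = refl
fromN-toN z3 = refl

infix 4 _≟₄_
_≟₄_ : DecidableEquality Z4
a ≟₄ b = map′ injective (cong toN) (toN a ℕ.≟ toN b)
  where
    injective : toN a ≡ toN b → a ≡ b
    injective eq = trans (sym (fromN-toN a)) (trans (cong fromN eq) (fromN-toN b))

all₄? : {P : Z4 → Set} → (∀ a → Dec (P a)) → Dec (∀ a → P a)
all₄? {P} P? = map′ everywhere (λ f → f z0 , f z1 , f z2 , f z3)
                 (P? z0 ×-dec P? z1 ×-dec P? z2 ×-dec P? z3)
  where
    everywhere : P z0 × P z1 × P z2 × P z3 → ∀ a → P a
    everywhere (p , _ , _ , _) z0 = p
    everywhere (_ , p , _ , _) z1 = p
    everywhere (_ , _ , p , _) z2 = p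
    everywhere (_ , _ , _ , p) z3 = p

+₄-assoc : ∀ a b c → (a +₄ b) +₄ c ≡ a +₄ (b +₄ c)
+₄-assoc = from-yes (all₄? λ a → all₄? λ b → all₄? λ c → (a +₄ b) +₄ c ≟₄ a +₄ (b +₄ c))

+₄-comm : ∀ a b → a +₄ b ≡ b +₄ a
+₄-comm = from-yes (all₄? λ a → all₄? λ b → a +₄ b ≟₄ b +₄ a)

+₄-identityˡ : ∀ a → z0 +₄ a ≡ a
+₄-identityˡ = from-yes (all₄? λ a → z0 +₄ a ≟₄ a)

+₄-inverseʳ : ∀ a → a +₄ (-₄ a) ≡ z0
+₄-inverseʳ = from-yes (all₄? λ a → a +₄ (-₄ a) ≟₄ z0)

+₄-interchange : ∀ a b c d → (a +₄ b) +₄ (c +₄ d) ≡ (a +₄ c) +₄ (b +₄ d)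
+₄-interchange = from-yes (all₄? λ a → all₄? λ b → all₄? λ c → all₄? λ d →
                   (a +₄ b) +₄ (c +₄ d) ≟₄ (a +₄ c) +₄ (b +₄ d))

*₄-assoc : ∀ a b c → (a *₄ b) *₄ c ≡ a *₄ (b *₄ c)
*₄-assoc = from-yes (all₄? λ a → all₄? λ b → all₄? λ c → (a *₄ b) *₄ c ≟₄ a *₄ (b *₄ c))

*₄-comm : ∀ a b → a *₄ b ≡ b *₄ a
*₄-comm = from-yes (all₄? λ a → all₄? λ b → a *₄ b ≟₄ b *₄ a)

*₄-identityˡ : ∀ a → z1 *₄ a ≡ a
*₄-identityˡ = from-yes (all₄? λ a → z1 *₄ a ≟₄ a)

*₄-zeroˡ : ∀ a → z0 *₄ a ≡ z0
*₄-zeroˡ = from-yes (all₄? λ a → z0 *₄ a ≟₄ z0)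

*₄-zeroʳ : ∀ a → a *₄ z0 ≡ z0
*₄-zeroʳ = from-yes (all₄? λ a → a *₄ z0 ≟₄ z0)

*₄-distribˡ : ∀ a b c → a *₄ (b +₄ c) ≡ a *₄ b +₄ a *₄ c
*₄-distribˡ = from-yes (all₄? λ a → all₄? λ b → all₄? λ c → a *₄ (b +₄ c) ≟₄ a *₄ b +₄ a *₄ c)

*₄-distribʳ : ∀ a b c → (b +₄ c) *₄ a ≡ b *₄ a +₄ c *₄ a
*₄-distribʳ = from-yes (all₄? λ a → all₄? λ b → all₄? λ c → (b +₄ c) *₄ a ≟₄ b *₄ a +₄ c *₄ a)

-₄≡z3*₄ : ∀ a → -₄ a ≡ z3 *₄ a
-₄≡z3*₄ = from-yes (all₄? λ a → -₄ a ≟₄ z3 *₄ a)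

infixl 6 _⊕_
infixl 7 _⊙_

_⊕_ : ∀ {k} → Vec Z4 k → Vec Z4 k → Vec Z4 k
_⊕_ = zipWith _+₄_

_⊙_ : ∀ {k} → Z4 → Vec Z4 k → Vec Z4 k
c ⊙ a = map (c *₄_) a

𝟘 : ∀ {k} → Vec Z4 k
𝟘 {k} = replicate k z0

⊕-assoc : ∀ {k} (a b c : Vec Z4 k) → (a ⊕ b) ⊕ c ≡ a ⊕ (b ⊕ c)
⊕-assoc = zipWith-assoc +₄-assoc

⊕-comm : ∀ {k} (a b : Vec Z4 k) → a ⊕ b ≡ b ⊕ a
⊕-comm = zipWith-comm +₄-comm

⊕-identityˡ : ∀ {k} (a : Vec Z4 k) → 𝟘 ⊕ a ≡ a
⊕-identityˡ = zipWith-identityˡ +₄-identityˡ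

⊕-identityʳ : ∀ {k} (a : Vec Z4 k) → a ⊕ 𝟘 ≡ a
⊕-identityʳ a = trans (⊕-comm a 𝟘) (⊕-identityˡ a)

⊕-inverseʳ : ∀ {k} (a : Vec Z4 k) → a ⊕ map -₄_ a ≡ 𝟘
⊕-inverseʳ = zipWith-inverseʳ +₄-inverseʳ

⊕-interchange : ∀ {k} (a b c d : Vec Z4 k) → (a ⊕ b) ⊕ (c ⊕ d) ≡ (a ⊕ c) ⊕ (b ⊕ d)
⊕-interchange [] [] [] [] = refl
⊕-interchange (a ∷ as) (b ∷ bs) (c ∷ cs) (d ∷ ds) =
  cong₂ _∷_ (+₄-interchange a b c d) (⊕-interchange as bs cs ds)

⊙-distribˡ : ∀ {k} c (a b : Vec Z4 k) → c ⊙ (a ⊕ b) ≡ c ⊙ a ⊕ c ⊙ b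
⊙-distribˡ c [] [] = refl
⊙-distribˡ c (a ∷ as) (b ∷ bs) = cong₂ _∷_ (*₄-distribˡ c a b) (⊙-distribˡ c as bs)

⊙-distribʳ : ∀ {k} c d (a : Vec Z4 k) → (c +₄ d) ⊙ a ≡ c ⊙ a ⊕ d ⊙ a
⊙-distribʳ c d [] = refl
⊙-distribʳ c d (a ∷ as) = cong₂ _∷_ (*₄-distribʳ a c d) (⊙-distribʳ c d as)

⊙-assoc : ∀ {k} c d (a : Vec Z4 k) → (c *₄ d) ⊙ a ≡ c ⊙ (d ⊙ a)
⊙-assoc c d a = trans (map-cong (*₄-assoc c d) a) (map-∘ (c *₄_) (d *₄_) a)

⊙-comm : ∀ {k} c d (a : Vec Z4 k) → c ⊙ (d ⊙ a) ≡ d ⊙ (c ⊙ a)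
⊙-comm c d a = trans (sym (⊙-assoc c d a)) (trans (cong (_⊙ a) (*₄-comm c d)) (⊙-assoc d c a))

⊙-identity : ∀ {k} (a : Vec Z4 k) → z1 ⊙ a ≡ a
⊙-identity a = trans (map-cong *₄-identityˡ a) (map-id a)

⊙-zeroˡ : ∀ {k} (a : Vec Z4 k) → z0 ⊙ a ≡ 𝟘
⊙-zeroˡ [] = refl
⊙-zeroˡ (a ∷ as) = cong₂ _∷_ (*₄-zeroˡ a) (⊙-zeroˡ as)

⊙-zeroʳ : ∀ {k} c → c ⊙ 𝟘 {k} ≡ 𝟘
⊙-zeroʳ {k} c = trans (map-replicate (c *₄_) z0 k) (cong (replicate k) (*₄-zeroʳ c))

⊖≡z3⊙ : ∀ {k} (a : Vec Z4 k) → map -₄_ a ≡ z3 ⊙ a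
⊖≡z3⊙ = map-cong -₄≡z3*₄

module WordDifference where
  open import Algebra.Properties.CommutativeSemigroup ℕₚ.+-commutativeSemigroup using (interchange)

  _⊖_ : ∀ {n} → Vec Z4 n → Vec Z4 n → Vec Z4 n
  e ⊖ e′ = e ⊕ map -₄_ e′

  leeWeight-⊖ : ∀ {n} (e e′ : Vec Z4 n) → leeWeight (e ⊖ e′) ≤ leeWeight e + leeWeight e′
  leeWeight-⊖ [] [] = z≤n
  leeWeight-⊖ (a ∷ e) (b ∷ e′) = ≤-trans (ℕₚ.+-mono-≤ (leeW-⊖ a b) (leeWeight-⊖ e e′))
                                         (ℕₚ.≤-reflexive (interchange (leeW a) (leeW b) _ _))
    where
      leeW-⊖ : ∀ a b → leeW (a +₄ (-₄ b)) ≤ leeW a + leeW b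
      leeW-⊖ = from-yes (all₄? λ a → all₄? λ b → leeW (a +₄ (-₄ b)) ℕ.≤? leeW a + leeW b)

  ⊖-zero : ∀ {n} (e e′ : Vec Z4 n) → e ⊖ e′ ≡ 𝟘 → e ≡ e′
  ⊖-zero [] [] _ = refl
  ⊖-zero (a ∷ e) (b ∷ e′) d≡0 = cong₂ _∷_ (sub-zero a b (∷-injectiveˡ d≡0)) (⊖-zero e e′ (∷-injectiveʳ d≡0))
    where
      sub-zero : ∀ a b → a +₄ (-₄ b) ≡ z0 → a ≡ b
      sub-zero = from-yes (all₄? λ a → all₄? λ b → (a +₄ (-₄ b) ≟₄ z0) →-dec (a ≟₄ b))

-- Multiplication a * b is Horner's scheme Σ aᵢ xⁱ b, built from the
-- Z₄-linear map "multiply by x".  Every Z₄-linear map commuting with x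
-- commutes with all multiplications; in particular multiplications commute
-- with each other, which gives commutativity and associativity at once.

module GaloisRingLaws (m : ℕ) (h : Vec Z4 m) where
  open GR m h
  open ≡-Reasoning

  shifted : ∀ {k} → Vec Z4 k → Z4 → Vec Z4 k
  shifted a c = proj₁ (shiftUp a c)

  overflow : ∀ {k} → Vec Z4 k → Z4 → Z4
  overflow a c = proj₂ (shiftUp a c)

  shiftUp-∷ : ∀ {k} x (xs : Vec Z4 k) c → shiftUp (x ∷ xs) c ≡ (c ∷ shifted xs x , overflow xs x)
  shiftUp-∷ x xs c with shiftUp xs x
  ... | ys , top = refl

  shiftUp-⊕ : ∀ {k} (a b : Vec Z4 k) c d →
    shiftUp (a ⊕ b) (c +₄ d) ≡ (shifted a c ⊕ shifted b d , overflow a c +₄ overflow b d)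
  shiftUp-⊕ [] [] c d = refl
  shiftUp-⊕ (x ∷ a) (y ∷ b) c d
    rewrite shiftUp-∷ (x +₄ y) (a ⊕ b) (c +₄ d) | shiftUp-⊕ a b x y
          | shiftUp-∷ x a c | shiftUp-∷ y b d = refl

  shiftUp-⊙ : ∀ {k} e (a : Vec Z4 k) c →
    shiftUp (e ⊙ a) (e *₄ c) ≡ (e ⊙ shifted a c , e *₄ overflow a c)
  shiftUp-⊙ e [] c = refl
  shiftUp-⊙ e (x ∷ a) c
    rewrite shiftUp-∷ (e *₄ x) (e ⊙ a) (e *₄ c) | shiftUp-⊙ e a x | shiftUp-∷ x a c = refl

  xmul-unfold : ∀ a → xmul a ≡ shifted a z0 ⊕ z3 ⊙ (overflow a z0 ⊙ h)
  xmul-unfold a with shiftUp a z0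
  ... | s , top = cong (s ⊕_) (⊖≡z3⊙ (top ⊙ h))

  record Linear (f : R → R) : Set where
    field
      additive    : ∀ a b → f (a ⊕ b) ≡ f a ⊕ f b
      homogeneous : ∀ c a → f (c ⊙ a) ≡ c ⊙ f a

    preserves-𝟘 : f 0R ≡ 0R
    preserves-𝟘 = begin
      f 0R         ≡⟨ cong f (sym (⊙-zeroˡ 0R)) ⟩
      f (z0 ⊙ 0R)  ≡⟨ homogeneous z0 0R ⟩
      z0 ⊙ f 0R    ≡⟨ ⊙-zeroˡ (f 0R) ⟩
      0R           ∎

  open Linear

  xmul-linear : Linear xmul
  additive xmul-linear a b = begin
      xmul (a ⊕ b)
    ≡⟨ xmul-unfold (a ⊕ b) ⟩
      shifted (a ⊕ b) z0 ⊕ z3 ⊙ (overflow (a ⊕ b) z0 ⊙ h)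
    ≡⟨ cong (λ p → proj₁ p ⊕ z3 ⊙ (proj₂ p ⊙ h)) (shiftUp-⊕ a b z0 z0) ⟩
      (sa ⊕ sb) ⊕ z3 ⊙ ((ta +₄ tb) ⊙ h)
    ≡⟨ cong (λ v → (sa ⊕ sb) ⊕ z3 ⊙ v) (⊙-distribʳ ta tb h) ⟩
      (sa ⊕ sb) ⊕ z3 ⊙ (ta ⊙ h ⊕ tb ⊙ h)
    ≡⟨ cong ((sa ⊕ sb) ⊕_) (⊙-distribˡ z3 (ta ⊙ h) (tb ⊙ h)) ⟩
      (sa ⊕ sb) ⊕ (z3 ⊙ (ta ⊙ h) ⊕ z3 ⊙ (tb ⊙ h))
    ≡⟨ ⊕-interchange sa sb _ _ ⟩
      (sa ⊕ z3 ⊙ (ta ⊙ h)) ⊕ (sb ⊕ z3 ⊙ (tb ⊙ h))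
    ≡⟨ sym (cong₂ _⊕_ (xmul-unfold a) (xmul-unfold b)) ⟩
      xmul a ⊕ xmul b ∎
    where sa = shifted a z0 ; sb = shifted b z0 ; ta = overflow a z0 ; tb = overflow b z0
  homogeneous xmul-linear e a = begin
      xmul (e ⊙ a)
    ≡⟨ xmul-unfold (e ⊙ a) ⟩
      shifted (e ⊙ a) z0 ⊕ z3 ⊙ (overflow (e ⊙ a) z0 ⊙ h)
    ≡⟨ cong (λ c → shifted (e ⊙ a) c ⊕ z3 ⊙ (overflow (e ⊙ a) c ⊙ h)) (sym (*₄-zeroʳ e)) ⟩
      shifted (e ⊙ a) (e *₄ z0) ⊕ z3 ⊙ (overflow (e ⊙ a) (e *₄ z0) ⊙ h)
    ≡⟨ cong (λ p → proj₁ p ⊕ z3 ⊙ (proj₂ p ⊙ h)) (shiftUp-⊙ e a z0) ⟩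
      e ⊙ sa ⊕ z3 ⊙ ((e *₄ ta) ⊙ h)
    ≡⟨ cong (λ v → e ⊙ sa ⊕ z3 ⊙ v) (⊙-assoc e ta h) ⟩
      e ⊙ sa ⊕ z3 ⊙ (e ⊙ (ta ⊙ h))
    ≡⟨ cong (e ⊙ sa ⊕_) (⊙-comm z3 e (ta ⊙ h)) ⟩
      e ⊙ sa ⊕ e ⊙ (z3 ⊙ (ta ⊙ h))
    ≡⟨ sym (⊙-distribˡ e sa _) ⟩
      e ⊙ (sa ⊕ z3 ⊙ (ta ⊙ h))
    ≡⟨ cong (e ⊙_) (sym (xmul-unfold a)) ⟩
      e ⊙ xmul a ∎
    where sa = shifted a z0 ; ta = overflow a z0

  mulAux-linear : ∀ {k} (as : Vec Z4 k) → Linear (mulAux as)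
  additive (mulAux-linear []) b b′ = sym (⊕-identityˡ 0R)
  additive (mulAux-linear (c ∷ as)) b b′ = begin
      c ⊙ (b ⊕ b′) ⊕ xmul (mulAux as (b ⊕ b′))
    ≡⟨ cong₂ (λ u v → u ⊕ xmul v) (⊙-distribˡ c b b′) (additive (mulAux-linear as) b b′) ⟩
      (c ⊙ b ⊕ c ⊙ b′) ⊕ xmul (mulAux as b ⊕ mulAux as b′)
    ≡⟨ cong ((c ⊙ b ⊕ c ⊙ b′) ⊕_) (additive xmul-linear (mulAux as b) (mulAux as b′)) ⟩
      (c ⊙ b ⊕ c ⊙ b′) ⊕ (xmul (mulAux as b) ⊕ xmul (mulAux as b′))
    ≡⟨ ⊕-interchange (c ⊙ b) (c ⊙ b′) _ _ ⟩
      (c ⊙ b ⊕ xmul (mulAux as b)) ⊕ (c ⊙ b′ ⊕ xmul (mulAux as b′)) ∎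
  homogeneous (mulAux-linear []) e b = sym (⊙-zeroʳ e)
  homogeneous (mulAux-linear (c ∷ as)) e b = begin
      c ⊙ (e ⊙ b) ⊕ xmul (mulAux as (e ⊙ b))
    ≡⟨ cong₂ (λ u v → u ⊕ xmul v) (⊙-comm c e b) (homogeneous (mulAux-linear as) e b) ⟩
      e ⊙ (c ⊙ b) ⊕ xmul (e ⊙ mulAux as b)
    ≡⟨ cong (e ⊙ (c ⊙ b) ⊕_) (homogeneous xmul-linear e (mulAux as b)) ⟩
      e ⊙ (c ⊙ b) ⊕ e ⊙ xmul (mulAux as b)
    ≡⟨ sym (⊙-distribˡ e _ _) ⟩
      e ⊙ (c ⊙ b ⊕ xmul (mulAux as b)) ∎

  mulAux-xmul : ∀ {k} (as : Vec Z4 k) b → mulAux as (xmul b) ≡ xmul (mulAux as b)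
  mulAux-xmul [] b = sym (preserves-𝟘 xmul-linear)
  mulAux-xmul (c ∷ as) b = begin
      c ⊙ xmul b ⊕ xmul (mulAux as (xmul b))
    ≡⟨ cong₂ (λ u v → u ⊕ xmul v) (sym (homogeneous xmul-linear c b)) (mulAux-xmul as b) ⟩
      xmul (c ⊙ b) ⊕ xmul (xmul (mulAux as b))
    ≡⟨ sym (additive xmul-linear (c ⊙ b) (xmul (mulAux as b))) ⟩
      xmul (c ⊙ b ⊕ xmul (mulAux as b)) ∎

  linear-mulAux : ∀ {f} → Linear f → (∀ a → f (xmul a) ≡ xmul (f a)) →
    ∀ {k} (bs : Vec Z4 k) c → f (mulAux bs c) ≡ mulAux bs (f c)
  linear-mulAux fl fx [] c = preserves-𝟘 fl
  linear-mulAux {f} fl fx (b ∷ bs) c = begin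
      f (b ⊙ c ⊕ xmul (mulAux bs c))
    ≡⟨ additive fl _ _ ⟩
      f (b ⊙ c) ⊕ f (xmul (mulAux bs c))
    ≡⟨ cong₂ _⊕_ (homogeneous fl b c) (fx (mulAux bs c)) ⟩
      b ⊙ f c ⊕ xmul (f (mulAux bs c))
    ≡⟨ cong (λ v → b ⊙ f c ⊕ xmul v) (linear-mulAux fl fx bs c) ⟩
      b ⊙ f c ⊕ xmul (mulAux bs (f c)) ∎

  exchange : ∀ {k} (as : Vec Z4 k) (b c : R) → mulAux as (mulAux b c) ≡ mulAux b (mulAux as c)
  exchange as = linear-mulAux (mulAux-linear as) (mulAux-xmul as)

  -- 1 is a right unit: a vector of length k ≤ m, padded with zeros to
  -- length m, is fixed by Horner's scheme applied to 1.
  padTo : ∀ n {k} → Vec Z4 k → Vec Z4 n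
  padTo n [] = replicate n z0
  padTo zero (c ∷ cs) = []
  padTo (suc n) (c ∷ cs) = c ∷ padTo n cs

  padTo-id : ∀ {n} (a : Vec Z4 n) → padTo n a ≡ a
  padTo-id [] = refl
  padTo-id (x ∷ a) = cong (x ∷_) (padTo-id a)

  shiftUp-𝟘 : ∀ {k} → shiftUp (𝟘 {k}) z0 ≡ (𝟘 , z0)
  shiftUp-𝟘 {zero} = refl
  shiftUp-𝟘 {suc k} rewrite shiftUp-∷ z0 (𝟘 {k}) z0 | shiftUp-𝟘 {k} = refl

  shiftUp-padTo : ∀ n {k} (cs : Vec Z4 k) d → k < n → shiftUp (padTo n cs) d ≡ (padTo n (d ∷ cs) , z0)
  shiftUp-padTo (suc n) [] d _ rewrite shiftUp-∷ z0 (𝟘 {n}) d | shiftUp-𝟘 {n} = refl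
  shiftUp-padTo (suc n) (c ∷ cs) d (s≤s k<n) rewrite shiftUp-∷ c (padTo n cs) d | shiftUp-padTo n cs c k<n = refl

  mulAux-1R : ∀ {k} (cs : Vec Z4 k) → k ≤ m → mulAux cs 1R ≡ padTo m cs
  mulAux-1R [] _ = refl
  mulAux-1R {suc k} (c ∷ cs) k<m = begin
      c ⊙ 1R ⊕ xmul (mulAux cs 1R)
    ≡⟨ cong (λ v → c ⊙ 1R ⊕ xmul v) (mulAux-1R cs (≤-trans (n≤1+n k) k<m)) ⟩
      c ⊙ 1R ⊕ xmul (padTo m cs)
    ≡⟨ cong (c ⊙ 1R ⊕_) (xmul-unfold (padTo m cs)) ⟩
      c ⊙ 1R ⊕ (shifted (padTo m cs) z0 ⊕ z3 ⊙ (overflow (padTo m cs) z0 ⊙ h))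
    ≡⟨ cong (λ p → c ⊙ 1R ⊕ (proj₁ p ⊕ z3 ⊙ (proj₂ p ⊙ h))) (shiftUp-padTo m cs z0 k<m) ⟩
      c ⊙ 1R ⊕ (padTo m (z0 ∷ cs) ⊕ z3 ⊙ (z0 ⊙ h))
    ≡⟨ cong (λ v → c ⊙ 1R ⊕ (padTo m (z0 ∷ cs) ⊕ z3 ⊙ v)) (⊙-zeroˡ h) ⟩
      c ⊙ 1R ⊕ (padTo m (z0 ∷ cs) ⊕ z3 ⊙ 0R)
    ≡⟨ cong (λ v → c ⊙ 1R ⊕ (padTo m (z0 ∷ cs) ⊕ v)) (⊙-zeroʳ z3) ⟩
      c ⊙ 1R ⊕ (padTo m (z0 ∷ cs) ⊕ 0R)
    ≡⟨ cong (c ⊙ 1R ⊕_) (⊕-identityʳ _) ⟩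
      c ⊙ 1R ⊕ padTo m (z0 ∷ cs)
    ≡⟨ constant-term m k<m ⟩
      padTo m (c ∷ cs) ∎
    where
      constant-term : ∀ n → suc k ≤ n → c ⊙ embed {n} z1 ⊕ padTo n (z0 ∷ cs) ≡ padTo n (c ∷ cs)
      constant-term (suc n) _ =
        cong₂ _∷_ (trans (+₄-comm (c *₄ z1) z0) (trans (+₄-identityˡ _) (trans (*₄-comm c z1) (*₄-identityˡ c))))
                  (trans (cong (_⊕ padTo n cs) (⊙-zeroʳ c)) (⊕-identityˡ _))

  *R-identityʳ : ∀ a → a *R 1R ≡ a
  *R-identityʳ a = trans (mulAux-1R a ≤-refl) (padTo-id a)

  *R-comm : ∀ a b → a *R b ≡ b *R a
  *R-comm a b = begin
    mulAux a b               ≡⟨ cong (mulAux a) (sym (*R-identityʳ b)) ⟩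
    mulAux a (mulAux b 1R)   ≡⟨ exchange a b 1R ⟩
    mulAux b (mulAux a 1R)   ≡⟨ cong (mulAux b) (*R-identityʳ a) ⟩
    mulAux b a               ∎

  *R-assoc : ∀ a b c → (a *R b) *R c ≡ a *R (b *R c)
  *R-assoc a b c = begin
    (a *R b) *R c  ≡⟨ *R-comm (a *R b) c ⟩
    c *R (a *R b)  ≡⟨ exchange c a b ⟩
    a *R (c *R b)  ≡⟨ cong (a *R_) (*R-comm c b) ⟩
    a *R (b *R c)  ∎

  *R-identityˡ : ∀ a → 1R *R a ≡ a
  *R-identityˡ a = trans (*R-comm 1R a) (*R-identityʳ a)

  Rcr : CommutativeRing 0ℓ 0ℓ
  Rcr = mkCommutativeRing R _≡_ isEquivalence _+R_ _*R_ -R_ 0R 1R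
    (cong₂ _+R_) (cong₂ _*R_) (cong (-R_))
    ⊕-assoc ⊕-comm ⊕-identityˡ ⊕-inverseʳ *R-assoc *R-comm *R-identityˡ
    (λ a → additive (mulAux-linear a))

  embed-*R : ∀ c b → embed c *R b ≡ c ⊙ b
  embed-*R c b = begin
      embed c *R b          ≡⟨ cong (_*R b) embed≡ ⟩
      (c ⊙ 1R) *R b         ≡⟨ *R-comm (c ⊙ 1R) b ⟩
      b *R (c ⊙ 1R)         ≡⟨ homogeneous (mulAux-linear b) c 1R ⟩
      c ⊙ (b *R 1R)         ≡⟨ cong (c ⊙_) (*R-identityʳ b) ⟩
      c ⊙ b                 ∎
    where
      embed≡ : ∀ {n} → embed {n} c ≡ c ⊙ embed z1
      embed≡ {zero} = refl
      embed≡ {suc n} = cong₂ _∷_ (sym (trans (*₄-comm c z1) (*₄-identityˡ c))) (sym (⊙-zeroʳ c))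

module SeriesRing (m : ℕ) (h : Vec Z4 m) where
  open GR m h
  open GaloisRingLaws m h using (Rcr)
  module Rc = CommutativeRing Rcr
  open import Algebra.Properties.Ring Rc.ring using (-0#≈0#; -‿+-comm)
  open ≡-Reasoning

  sum-cong : ∀ k {f g : ℕ → R} → (∀ i → i ≤ k → f i ≡ g i) → sumUpTo k f ≡ sumUpTo k g
  sum-cong zero eq = eq 0 z≤n
  sum-cong (suc k) eq = cong₂ _+R_ (sum-cong k (λ i i≤k → eq i (m≤n⇒m≤1+n i≤k))) (eq (suc k) ≤-refl)

  sum-zero : ∀ k {f : ℕ → R} → (∀ i → i ≤ k → f i ≡ 0R) → sumUpTo k f ≡ 0R
  sum-zero zero eq = eq 0 z≤n
  sum-zero (suc k) eq =
    trans (cong₂ _+R_ (sum-zero k (λ i i≤k → eq i (m≤n⇒m≤1+n i≤k))) (eq (suc k) ≤-refl)) (Rc.+-identityʳ 0R)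

  sum-add : ∀ k (f g : ℕ → R) → sumUpTo k (λ i → f i +R g i) ≡ sumUpTo k f +R sumUpTo k g
  sum-add zero f g = refl
  sum-add (suc k) f g =
    trans (cong (_+R (f (suc k) +R g (suc k))) (sum-add k f g))
          (⊕-interchange (sumUpTo k f) (sumUpTo k g) (f (suc k)) (g (suc k)))

  sum-mulˡ : ∀ k c (f : ℕ → R) → c *R sumUpTo k f ≡ sumUpTo k (λ i → c *R f i)
  sum-mulˡ zero c f = refl
  sum-mulˡ (suc k) c f =
    trans (Rc.distribˡ c (sumUpTo k f) (f (suc k))) (cong (_+R (c *R f (suc k))) (sum-mulˡ k c f))

  sum-mulʳ : ∀ k c (f : ℕ → R) → sumUpTo k f *R c ≡ sumUpTo k (λ i → f i *R c)
  sum-mulʳ k c f = trans (Rc.*-comm _ c) (trans (sum-mulˡ k c f) (sum-cong k (λ i _ → Rc.*-comm c (f i))))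

  sum-neg : ∀ k (f : ℕ → R) → -R sumUpTo k f ≡ sumUpTo k (λ i → -R f i)
  sum-neg zero f = refl
  sum-neg (suc k) f = trans (sym (-‿+-comm _ _)) (cong (_+R (-R f (suc k))) (sum-neg k f))

  sum-shift : ∀ k (f : ℕ → R) → sumUpTo (suc k) f ≡ f 0 +R sumUpTo k (λ i → f (suc i))
  sum-shift zero f = refl
  sum-shift (suc k) f =
    trans (cong (_+R f (suc (suc k))) (sum-shift k f)) (Rc.+-assoc _ _ _)

  sum-rev : ∀ k (f : ℕ → R) → sumUpTo k f ≡ sumUpTo k (λ i → f (k ∸ i))
  sum-rev zero f = refl
  sum-rev (suc k) f = begin
    sumUpTo k f +R f (suc k)                     ≡⟨ Rc.+-comm _ _ ⟩
    f (suc k) +R sumUpTo k f                     ≡⟨ cong (f (suc k) +R_) (sum-rev k f) ⟩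
    f (suc k) +R sumUpTo k (λ i → f (k ∸ i))     ≡⟨ sym (sum-shift k (λ i → f (suc k ∸ i))) ⟩
    sumUpTo (suc k) (λ i → f (suc k ∸ i))        ∎

  suc-∸ : ∀ {j k} → j ≤ k → suc k ∸ j ≡ suc (k ∸ j)
  suc-∸ j≤k = +-∸-assoc 1 j≤k

  sum-triangle : ∀ k (F : ℕ → ℕ → R) →
    sumUpTo k (λ i → sumUpTo i (λ j → F j (i ∸ j))) ≡ sumUpTo k (λ j → sumUpTo (k ∸ j) (F j))
  sum-triangle zero F = refl
  sum-triangle (suc k) F = begin
      sumUpTo k (λ i → sumUpTo i (λ j → F j (i ∸ j))) +R sumUpTo (suc k) (λ j → F j (suc k ∸ j))
    ≡⟨ cong (_+R sumUpTo (suc k) (λ j → F j (suc k ∸ j))) (sum-triangle k F) ⟩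
      A +R (sumUpTo k (λ j → F j (suc k ∸ j)) +R last)
    ≡⟨ cong (λ w → A +R (w +R last)) (sum-cong k (λ j j≤k → cong (F j) (suc-∸ j≤k))) ⟩
      A +R (sumUpTo k (λ j → F j (suc (k ∸ j))) +R last)
    ≡⟨ sym (Rc.+-assoc A _ last) ⟩
      (A +R sumUpTo k (λ j → F j (suc (k ∸ j)))) +R last
    ≡⟨ cong (_+R last) (sym (sum-add k _ _)) ⟩
      sumUpTo k (λ j → sumUpTo (k ∸ j) (F j) +R F j (suc (k ∸ j))) +R last
    ≡⟨ cong₂ _+R_ (sum-cong k (λ j j≤k → cong (λ w → sumUpTo w (F j)) (sym (suc-∸ j≤k))))
                  last-term ⟩
      sumUpTo k (λ j → sumUpTo (suc k ∸ j) (F j)) +R sumUpTo (suc k ∸ suc k) (F (suc k)) ∎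
    where
      A = sumUpTo k (λ j → sumUpTo (k ∸ j) (F j))
      last = F (suc k) (k ∸ k)
      last-term : last ≡ sumUpTo (k ∸ k) (F (suc k))
      last-term rewrite n∸n≡0 k = refl

  infix 4 _≈S_
  _≈S_ : Series → Series → Set
  a ≈S b = ∀ k → a k ≡ b k

  negS : Series → Series
  negS a k = -R a k

  zeroS : Series
  zeroS _ = 0R

  mulS-cong : ∀ {a a′ b b′} → a ≈S a′ → b ≈S b′ → mulS a b ≈S mulS a′ b′
  mulS-cong a≈ b≈ k = sum-cong k (λ i _ → cong₂ _*R_ (a≈ i) (b≈ (k ∸ i)))

  mulS-comm : ∀ a b → mulS a b ≈S mulS b a
  mulS-comm a b k = begin
      sumUpTo k (λ i → a i *R b (k ∸ i))
    ≡⟨ sum-rev k _ ⟩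
      sumUpTo k (λ i → a (k ∸ i) *R b (k ∸ (k ∸ i)))
    ≡⟨ sum-cong k (λ i i≤k → trans (cong (λ w → a (k ∸ i) *R b w) (m∸[m∸n]≡n i≤k)) (Rc.*-comm (a (k ∸ i)) (b i))) ⟩
      sumUpTo k (λ i → b i *R a (k ∸ i)) ∎

  mulS-assoc : ∀ a b c → mulS (mulS a b) c ≈S mulS a (mulS b c)
  mulS-assoc a b c k = begin
      sumUpTo k (λ i → sumUpTo i (λ j → a j *R b (i ∸ j)) *R c (k ∸ i))
    ≡⟨ sum-cong k (λ i _ → sum-mulʳ i (c (k ∸ i)) _) ⟩
      sumUpTo k (λ i → sumUpTo i (λ j → (a j *R b (i ∸ j)) *R c (k ∸ i)))
    ≡⟨ sum-cong k (λ i i≤k → sum-cong i (λ j j≤i → cong (λ w → (a j *R b (i ∸ j)) *R c w) (sym (index j≤i)))) ⟩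
      sumUpTo k (λ i → sumUpTo i (λ j → F j (i ∸ j)))
    ≡⟨ sum-triangle k F ⟩
      sumUpTo k (λ j → sumUpTo (k ∸ j) (F j))
    ≡⟨ sum-cong k (λ j _ → trans (sum-cong (k ∸ j) (λ l _ → Rc.*-assoc (a j) (b l) (c (k ∸ j ∸ l))))
                                 (sym (sum-mulˡ (k ∸ j) (a j) _))) ⟩
      sumUpTo k (λ j → a j *R sumUpTo (k ∸ j) (λ l → b l *R c (k ∸ j ∸ l))) ∎
    where
      F : ℕ → ℕ → R
      F j l = (a j *R b l) *R c (k ∸ j ∸ l)
      index : ∀ {i j} → j ≤ i → k ∸ j ∸ (i ∸ j) ≡ k ∸ i
      index {i} {j} j≤i = trans (∸-+-assoc k j (i ∸ j)) (cong (k ∸_) (m+[n∸m]≡n j≤i))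

  mulS-distribˡ : ∀ a b c → mulS a (addS b c) ≈S addS (mulS a b) (mulS a c)
  mulS-distribˡ a b c k = trans (sum-cong k (λ i _ → Rc.distribˡ (a i) _ _)) (sum-add k _ _)

  mulS-identityˡ : ∀ b → mulS oneS b ≈S b
  mulS-identityˡ b zero = Rc.*-identityˡ (b 0)
  mulS-identityˡ b (suc k) = begin
      sumUpTo (suc k) (λ i → oneS i *R b (suc k ∸ i))
    ≡⟨ sum-shift k _ ⟩
      1R *R b (suc k) +R sumUpTo k (λ i → 0R *R b (k ∸ i))
    ≡⟨ cong₂ _+R_ (Rc.*-identityˡ _) (sum-zero k (λ i _ → Rc.zeroˡ _)) ⟩
      b (suc k) +R 0R
    ≡⟨ Rc.+-identityʳ _ ⟩
      b (suc k) ∎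

  Scr : CommutativeRing 0ℓ 0ℓ
  Scr = mkCommutativeRing Series _≈S_
    (record { refl = λ k → refl ; sym = λ p k → sym (p k) ; trans = λ p q k → trans (p k) (q k) })
    addS mulS negS zeroS oneS
    (λ p q k → cong₂ _+R_ (p k) (q k)) mulS-cong (λ p k → cong (-R_) (p k))
    (λ a b c k → Rc.+-assoc _ _ _) (λ a b k → Rc.+-comm _ _) (λ a k → Rc.+-identityˡ _)
    (λ a k → Rc.-‿inverseʳ _) mulS-assoc mulS-comm mulS-identityˡ mulS-distribˡ

  tailS : Series → Series
  tailS a k = a (suc k)

  invS-dot : ∀ a k off → dotS a (invRev a (suc k)) off ≡ sumUpTo k (λ i → a (suc (i + off)) *R invS a (k ∸ i))
  invS-dot a zero off = Rc.+-identityʳ _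
  invS-dot a (suc k) off = begin
      a (suc off) *R invS a (suc k) +R dotS a (invRev a (suc k)) (suc off)
    ≡⟨ cong (a (suc off) *R invS a (suc k) +R_) (invS-dot a k (suc off)) ⟩
      a (suc off) *R invS a (suc k) +R sumUpTo k (λ i → a (suc (i + suc off)) *R invS a (k ∸ i))
    ≡⟨ cong (a (suc off) *R invS a (suc k) +R_)
            (sum-cong k (λ i _ → cong (λ w → a (suc w) *R invS a (k ∸ i)) (+-suc i off))) ⟩
      a (suc off) *R invS a (suc k) +R sumUpTo k (λ i → a (suc (suc i + off)) *R invS a (k ∸ i))
    ≡⟨ sym (sum-shift k (λ i → a (suc (i + off)) *R invS a (suc k ∸ i))) ⟩
      sumUpTo (suc k) (λ i → a (suc (i + off)) *R invS a (suc k ∸ i)) ∎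

  invS-zero : ∀ a → invS a 0 ≡ 1R
  invS-zero a = trans (cong (1R +R_) -0#≈0#) (Rc.+-identityʳ 1R)

  invS-suc : ∀ a k → invS a (suc k) ≡ -R mulS (tailS a) (invS a) k
  invS-suc a k = begin
      0R +R (-R dotS a (invRev a (suc k)) 0)
    ≡⟨ Rc.+-identityˡ _ ⟩
      -R dotS a (invRev a (suc k)) 0
    ≡⟨ cong (-R_) (invS-dot a k 0) ⟩
      -R sumUpTo k (λ i → a (suc (i + 0)) *R invS a (k ∸ i))
    ≡⟨ cong (-R_) (sum-cong k (λ i _ → cong (λ w → a (suc w) *R invS a (k ∸ i)) (ℕₚ.+-identityʳ i))) ⟩
      -R mulS (tailS a) (invS a) k ∎

  invS-inverse : ∀ a → a 0 ≡ 1R → mulS a (invS a) ≈S oneS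
  invS-inverse a a₀≡1 zero = trans (cong₂ _*R_ a₀≡1 (invS-zero a)) (Rc.*-identityˡ 1R)
  invS-inverse a a₀≡1 (suc k) = begin
      sumUpTo (suc k) (λ i → a i *R invS a (suc k ∸ i))
    ≡⟨ sum-shift k _ ⟩
      a 0 *R invS a (suc k) +R S
    ≡⟨ cong₂ (λ x y → x *R y +R S) a₀≡1 (invS-suc a k) ⟩
      1R *R (-R S) +R S
    ≡⟨ cong (_+R S) (Rc.*-identityˡ (-R S)) ⟩
      (-R S) +R S
    ≡⟨ Rc.-‿inverseˡ S ⟩
      0R ∎
    where S = mulS (tailS a) (invS a) k

module Truncation (m : ℕ) (h : Vec Z4 m) where
  open GR m h
  open SeriesRing m h
  open import Algebra.Properties.Ring Rc.ring using (-0#≈0#)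

  Below : ℕ → (ℕ → Set) → Set
  Below N Q = ∀ k → k < N → Q k

  below-mono : ∀ {N N′ Q} → N ≤ N′ → Below N′ Q → Below N Q
  below-mono N≤N′ q k k<N = q k (<-≤-trans k<N N≤N′)

  below-suc : ∀ {N Q} → Below N Q → Q N → Below (suc N) Q
  below-suc {N} q qN k k<1+N with m<1+n⇒m<n∨m≡n k<1+N
  ... | inj₁ k<N = q k k<N
  ... | inj₂ refl = qN

  Agree : ℕ → Series → Series → Set
  Agree N a b = Below N (λ k → a k ≡ b k)

  agree-≈ : ∀ {N a a′ b b′} → a ≈S a′ → b ≈S b′ → Agree N a′ b′ → Agree N a b
  agree-≈ a≈ b≈ ab k k<N = trans (a≈ k) (trans (ab k k<N) (sym (b≈ k)))

  agree-mulS : ∀ {N a a′ b b′} → Agree N a a′ → Agree N b b′ → Agree N (mulS a b) (mulS a′ b′)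
  agree-mulS aa bb k k<N = sum-cong k λ i i≤k →
    cong₂ _*R_ (aa i (≤-<-trans i≤k k<N)) (bb (k ∸ i) (≤-<-trans (m∸n≤m k i) k<N))

  agree-tailS : ∀ {N a a′} → Agree (suc N) a a′ → Agree N (tailS a) (tailS a′)
  agree-tailS aa k k<N = aa (suc k) (s≤s k<N)

  agree-invS : ∀ N {a a′} → Agree N a a′ → Agree N (invS a) (invS a′)
  agree-invS zero _ = λ _ ()
  agree-invS (suc zero) {a} {a′} _ = below-suc (λ _ ()) (trans (invS-zero a) (sym (invS-zero a′)))
  agree-invS (suc (suc N)) {a} {a′} aa =
    let below = agree-invS (suc N) (below-mono (n≤1+n _) aa) in
    below-suc below (trans (invS-suc a N)
      (trans (cong (-R_) (agree-mulS (agree-tailS aa) below N ≤-refl)) (sym (invS-suc a′ N))))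

  agree-cancel : ∀ {N} x {y y′} → Agree N y y′ → Agree N (addS x (addS y (negS y′))) x
  agree-cancel x {y} {y′} yy k k<N = begin
      x k +R (y k +R (-R y′ k))   ≡⟨ cong (λ w → x k +R (w +R (-R y′ k))) (yy k k<N) ⟩
      x k +R (y′ k +R (-R y′ k))  ≡⟨ cong (x k +R_) (Rc.-‿inverseʳ (y′ k)) ⟩
      x k +R 0R                   ≡⟨ Rc.+-identityʳ (x k) ⟩
      x k                         ∎
    where open ≡-Reasoning

  isOdd : ℕ → Bool
  isOdd k = not (isEven k)

  isOdd-suc : ∀ k → isOdd (suc k) ≡ not (isOdd k)
  isOdd-suc zero = refl
  isOdd-suc (suc zero) = refl
  isOdd-suc (suc (suc k)) = isOdd-suc k

  isOdd-+ : ∀ i j → isOdd (i + j) ≡ isOdd i xor isOdd j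
  isOdd-+ zero j = refl
  isOdd-+ (suc i) j = begin
    isOdd (suc (i + j))              ≡⟨ isOdd-suc (i + j) ⟩
    not (isOdd (i + j))              ≡⟨ cong not (isOdd-+ i j) ⟩
    not (isOdd i xor isOdd j)        ≡⟨ not-distribˡ-xor (isOdd i) (isOdd j) ⟩
    not (isOdd i) xor isOdd j        ≡⟨ cong (_xor isOdd j) (sym (isOdd-suc i)) ⟩
    isOdd (suc i) xor isOdd j        ∎
    where open ≡-Reasoning

  isOdd-false⇒double : ∀ k → isOdd k ≡ false → ∃ λ j → k ≡ 2 * j
  isOdd-false⇒double zero _ = 0 , refl
  isOdd-false⇒double (suc zero) ()
  isOdd-false⇒double (suc (suc k)) even with isOdd-false⇒double k even
  ... | j , refl = suc j , cong suc (sym (+-suc j (j + 0)))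

  -- Below degree N, a vanishes in all degrees whose oddness differs from p
  -- (p = false: a is even below N; p = true: a is odd below N).
  ParityBelow : Bool → ℕ → Series → Set
  ParityBelow p N a = Below N (λ k → isOdd k ≢ p → a k ≡ 0R)

  odd≢even : ∀ k → isOdd k ≡ true → isOdd k ≢ false
  odd≢even k k-odd k-even with () ← trans (sym k-odd) k-even

  parity-agree : ∀ {p N a b} → Agree N a b → ParityBelow p N b → ParityBelow p N a
  parity-agree ab pb k k<N k≢p = trans (ab k k<N) (pb k k<N k≢p)

  parity-addS : ∀ {p N a b} → ParityBelow p N a → ParityBelow p N b → ParityBelow p N (addS a b)
  parity-addS pa pb k k<N k≢p = trans (cong₂ _+R_ (pa k k<N k≢p) (pb k k<N k≢p)) (Rc.+-identityʳ 0R)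

  parity-negS : ∀ {p N a} → ParityBelow p N a → ParityBelow p N (negS a)
  parity-negS pa k k<N k≢p = trans (cong (-R_) (pa k k<N k≢p)) -0#≈0#

  parity-mulS : ∀ {p q N a b} → ParityBelow p N a → ParityBelow q N b → ParityBelow (p xor q) N (mulS a b)
  parity-mulS {p} {q} {N} {a} {b} pa qb k k<N k≢ = sum-zero k term
    where
      term : ∀ i → i ≤ k → a i *R b (k ∸ i) ≡ 0R
      term i i≤k with isOdd i Data.Bool.≟ p
      ... | no i≢p = trans (cong (_*R b (k ∸ i)) (pa i (≤-<-trans i≤k k<N) i≢p)) (Rc.zeroˡ _)
      ... | yes i≡p = trans (cong (a i *R_) (qb (k ∸ i) (≤-<-trans (m∸n≤m k i) k<N) k∸i≢q)) (Rc.zeroʳ (a i))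
        where
          k∸i≢q : isOdd (k ∸ i) ≢ q
          k∸i≢q k∸i≡q = k≢ (trans (cong isOdd (sym (m+[n∸m]≡n i≤k)))
                                  (trans (isOdd-+ i (k ∸ i)) (cong₂ _xor_ i≡p k∸i≡q)))

  parity-tailS : ∀ {p N a} → ParityBelow p (suc N) a → ParityBelow (not p) N (tailS a)
  parity-tailS {p} pa k k<N k≢ = pa (suc k) (s≤s k<N) λ 1+k≡p →
    k≢ (trans (sym (not-involutive (isOdd k))) (trans (sym (cong not (isOdd-suc k))) (cong not 1+k≡p)))

  parity-zS : ∀ {p N a} → ParityBelow p N a → ParityBelow (not p) (suc N) (zS a)
  parity-zS pa zero _ _ = refl
  parity-zS {p} pa (suc k) (s≤s k<N) 1+k≢ = pa k k<N λ k≡p → 1+k≢ (trans (isOdd-suc k) (cong not k≡p))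

  parity-oneS : ∀ {N} → ParityBelow false N oneS
  parity-oneS zero _ 0≢ = ⊥-elim (0≢ refl)
  parity-oneS (suc k) _ _ = refl

  parity-evenS : ∀ {N} σ → ParityBelow false N (evenS σ)
  parity-evenS σ k _ k≢ with isEven k
  ... | true = ⊥-elim (k≢ refl)
  ... | false = refl

  parity-oddS : ∀ {N} σ → ParityBelow true N (oddS σ)
  parity-oddS σ k _ k≢ with isEven k
  ... | true = refl
  ... | false = ⊥-elim (k≢ refl)

  parity-invS : ∀ N {a} → ParityBelow false N a → ParityBelow false N (invS a)
  parity-invS zero _ = λ _ ()
  parity-invS (suc zero) _ = below-suc (λ _ ()) (λ 0≢ → ⊥-elim (0≢ refl))
  parity-invS (suc (suc N)) {a} pa =
    let below = parity-invS (suc N) (below-mono (n≤1+n _) pa) in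
    below-suc below λ 1+N-odd → trans (invS-suc a N)
      (trans (cong (-R_) (parity-mulS (parity-tailS pa) below N ≤-refl
                            λ N-odd → 1+N-odd (trans (isOdd-suc N) (cong not N-odd))))
             -0#≈0#)

-- The formal derivative in the form (D a)_k = k · a_k (that is, z a′), the
-- sign twist a(z) ↦ a(-z), and logarithmic derivatives: ℓ is a logarithmic
-- derivative of a when D a = a ℓ.  The locator Π (1 - X_i z)^{w(e_i)} has
-- the logarithmic derivative ℓ_k = - Σ_i w(e_i) X_i^k, whose odd
-- coefficients are the syndromes of e.
module LogDerivative (m : ℕ) (h : Vec Z4 m) where
  open GR m h
  open GaloisRingLaws m h using (Rcr; embed-*R)
  open SeriesRing m h
  open Truncation m h
  open import Algebra.Properties.Ring Rc.ring using (-0#≈0#; -‿+-comm; -‿involutive; -‿distribˡ-*; -‿distribʳ-*)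
  open import Algebra.Properties.Semiring.Mult Rc.semiring using (×-homo-+; ×-assoc-*; ×-comm-*) renaming (_×_ to _×R_)
  open import Algebra.Properties.Semiring.Exp Rc.semiring using (_^_; ^-assocʳ)
  open RingIdentities Scr using (log-product)
  module Sc = CommutativeRing Scr
  open ≡-Reasoning

  D : Series → Series
  D a k = k ×R a k

  ×≡* : ∀ n x → n ×R x ≡ (n ×R 1R) *R x
  ×≡* n x = trans (cong (n ×R_) (sym (Rc.*-identityˡ x))) (sym (×-assoc-* n 1R x))

  ×-zero : ∀ n → n ×R 0R ≡ 0R
  ×-zero n = trans (×≡* n 0R) (Rc.zeroʳ (n ×R 1R))

  leibniz : ∀ a b → D (mulS a b) ≈S addS (mulS (D a) b) (mulS a (D b))
  leibniz a b k = begin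
      k ×R sumUpTo k (λ i → a i *R b (k ∸ i))
    ≡⟨ ×≡* k _ ⟩
      (k ×R 1R) *R sumUpTo k (λ i → a i *R b (k ∸ i))
    ≡⟨ sum-mulˡ k (k ×R 1R) (λ i → a i *R b (k ∸ i)) ⟩
      sumUpTo k (λ i → (k ×R 1R) *R (a i *R b (k ∸ i)))
    ≡⟨ sum-cong k term ⟩
      sumUpTo k (λ i → (i ×R a i) *R b (k ∸ i) +R a i *R ((k ∸ i) ×R b (k ∸ i)))
    ≡⟨ sum-add k _ _ ⟩
      mulS (D a) b k +R mulS a (D b) k ∎
    where
      term : ∀ i → i ≤ k → (k ×R 1R) *R (a i *R b (k ∸ i)) ≡ (i ×R a i) *R b (k ∸ i) +R a i *R ((k ∸ i) ×R b (k ∸ i))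
      term i i≤k = begin
          (k ×R 1R) *R (a i *R b (k ∸ i))
        ≡⟨ sym (×≡* k _) ⟩
          k ×R (a i *R b (k ∸ i))
        ≡⟨ cong (_×R (a i *R b (k ∸ i))) (sym (m+[n∸m]≡n i≤k)) ⟩
          (i + (k ∸ i)) ×R (a i *R b (k ∸ i))
        ≡⟨ ×-homo-+ _ i (k ∸ i) ⟩
          i ×R (a i *R b (k ∸ i)) +R (k ∸ i) ×R (a i *R b (k ∸ i))
        ≡⟨ sym (cong₂ _+R_ (×-assoc-* i (a i) (b (k ∸ i))) (×-comm-* (k ∸ i) (a i) (b (k ∸ i)))) ⟩
          (i ×R a i) *R b (k ∸ i) +R a i *R ((k ∸ i) ×R b (k ∸ i)) ∎

  parity-D : ∀ {p N a} → ParityBelow p N a → ParityBelow p N (D a)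
  parity-D pa k k<N k≢p = trans (cong (k ×R_) (pa k k<N k≢p)) (×-zero k)

  infix 4 _HasLogDerivative_
  _HasLogDerivative_ : Series → Series → Set
  a HasLogDerivative ℓ = D a ≈S mulS a ℓ

  logD-mulS : ∀ {a b l r} → a HasLogDerivative l → b HasLogDerivative r → mulS a b HasLogDerivative addS l r
  logD-mulS {a} {b} {l} {r} al br k = begin
    D (mulS a b) k                              ≡⟨ leibniz a b k ⟩
    mulS (D a) b k +R mulS a (D b) k            ≡⟨ cong₂ _+R_ (mulS-cong {b = b} al (λ _ → refl) k) (mulS-cong {a} {a} (λ _ → refl) br k) ⟩
    mulS (mulS a l) b k +R mulS a (mulS b r) k  ≡⟨ log-product a l b r k ⟩
    mulS (mulS a b) (addS l r) k                ∎

  logD-oneS : oneS HasLogDerivative zeroS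
  logD-oneS k = trans (D1≡0 k) (sym (Sc.*-identityˡ zeroS k))
    where
      D1≡0 : ∀ k → D oneS k ≡ 0R
      D1≡0 zero = refl
      D1≡0 (suc k) = ×-zero (suc k)

  _×S_ : ℕ → Series → Series
  (w ×S l) k = w ×R l k

  logD-powS : ∀ {F l} → F HasLogDerivative l → ∀ w → powS F w HasLogDerivative (w ×S l)
  logD-powS Fl zero = logD-oneS
  logD-powS {F} {l} Fl (suc w) = logD-mulS {F} {powS F w} {l} {w ×S l} Fl (logD-powS {F} {l} Fl w)

  geomLog : R → Series
  geomLog X zero = 0R
  geomLog X (suc k) = -R (X ^R suc k)

  mulS-oneMinus : ∀ X b k → mulS (oneMinus X) b (suc k) ≡ b (suc k) +R (-R X) *R b k
  mulS-oneMinus X b k = trans (sum-shift k _) (cong₂ _+R_ (Rc.*-identityˡ (b (suc k))) (rest k))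
    where
      rest : ∀ k → sumUpTo k (λ i → oneMinus X (suc i) *R b (k ∸ i)) ≡ (-R X) *R b k
      rest zero = refl
      rest (suc k) = trans (sum-shift k _)
        (trans (cong ((-R X) *R b (suc k) +R_) (sum-zero k (λ i _ → Rc.zeroˡ _))) (Rc.+-identityʳ _))

  neg*neg : ∀ x y → (-R x) *R (-R y) ≡ x *R y
  neg*neg x y = trans (sym (-‿distribˡ-* x (-R y))) (trans (cong (-R_) (sym (-‿distribʳ-* x y))) (-‿involutive _))

  logD-oneMinus : ∀ X → oneMinus X HasLogDerivative geomLog X
  logD-oneMinus X zero = sym (Rc.*-identityˡ 0R)
  logD-oneMinus X (suc zero) = begin
      -R X +R 0R                          ≡⟨ cong₂ _+R_ (cong (-R_) (sym (Rc.*-identityʳ X))) (sym (Rc.zeroʳ (-R X))) ⟩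
      -R (X *R 1R) +R (-R X) *R 0R        ≡⟨ sym (mulS-oneMinus X (geomLog X) 0) ⟩
      mulS (oneMinus X) (geomLog X) 1     ∎
  logD-oneMinus X (suc (suc k)) = begin
      suc (suc k) ×R 0R                           ≡⟨ ×-zero (suc (suc k)) ⟩
      0R                                         ≡⟨ sym (Rc.-‿inverseˡ Y) ⟩
      -R Y +R Y                                  ≡⟨ cong (-R Y +R_) (sym (neg*neg X (X ^R suc k))) ⟩
      -R Y +R (-R X) *R (-R (X ^R suc k))        ≡⟨ sym (mulS-oneMinus X (geomLog X) (suc k)) ⟩
      mulS (oneMinus X) (geomLog X) (suc (suc k)) ∎
    where Y = X ^R suc (suc k)

  locatorLog : R → ℕ → ∀ {k} → Vec Z4 k → Series
  locatorLog α i [] = zeroS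
  locatorLog α i (c ∷ cs) = addS (leeW c ×S geomLog (Xval α i c)) (locatorLog α (suc i) cs)

  logD-locFrom : ∀ α i {k} (e : Vec Z4 k) → locFrom α i e HasLogDerivative locatorLog α i e
  logD-locFrom α i [] = logD-oneS
  logD-locFrom α i (c ∷ cs) =
    logD-mulS {powS (oneMinus (Xval α i c)) (leeW c)} {locFrom α (suc i) cs}
              {leeW c ×S geomLog (Xval α i c)} {locatorLog α (suc i) cs}
      (logD-powS {oneMinus (Xval α i c)} {geomLog (Xval α i c)} (logD-oneMinus (Xval α i c)) (leeW c)) (logD-locFrom α (suc i) cs)

  locFrom-constant : ∀ α i {k} (e : Vec Z4 k) → locFrom α i e 0 ≡ 1R
  locFrom-constant α i [] = refl
  locFrom-constant α i (c ∷ cs) =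
    trans (cong₂ _*R_ (powS-constant (leeW c)) (locFrom-constant α (suc i) cs)) (Rc.*-identityˡ 1R)
    where
      powS-constant : ∀ w → powS (oneMinus (Xval α i c)) w 0 ≡ 1R
      powS-constant zero = refl
      powS-constant (suc w) = trans (cong (1R *R_) (powS-constant w)) (Rc.*-identityˡ 1R)

  sign : Bool → R → R
  sign false x = x
  sign true x = -R x

  sign-*R : ∀ p q x y → sign p x *R sign q y ≡ sign (p xor q) (x *R y)
  sign-*R false false x y = refl
  sign-*R false true x y = sym (-‿distribʳ-* x y)
  sign-*R true false x y = sym (-‿distribˡ-* x y)
  sign-*R true true x y = neg*neg x y

  sign-sum : ∀ p k (f : ℕ → R) → sign p (sumUpTo k f) ≡ sumUpTo k (λ i → sign p (f i))
  sign-sum false k f = refl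
  sign-sum true k f = sum-neg k f

  sign-× : ∀ p n x → n ×R sign p x ≡ sign p (n ×R x)
  sign-× false n x = refl
  sign-× true n x = trans (×≡* n (-R x)) (trans (sym (-‿distribʳ-* (n ×R 1R) x)) (cong (-R_) (sym (×≡* n x))))

  twist : Series → Series
  twist a k = sign (isOdd k) (a k)

  twist-mulS : ∀ a b → twist (mulS a b) ≈S mulS (twist a) (twist b)
  twist-mulS a b k = begin
      sign (isOdd k) (sumUpTo k (λ i → a i *R b (k ∸ i)))
    ≡⟨ sign-sum (isOdd k) k _ ⟩
      sumUpTo k (λ i → sign (isOdd k) (a i *R b (k ∸ i)))
    ≡⟨ sum-cong k (λ i i≤k → trans (cong (λ p → sign p (a i *R b (k ∸ i))) (oddness i≤k))
                                   (sym (sign-*R (isOdd i) (isOdd (k ∸ i)) (a i) (b (k ∸ i))))) ⟩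
      sumUpTo k (λ i → twist a i *R twist b (k ∸ i)) ∎
    where
      oddness : ∀ {i} → i ≤ k → isOdd k ≡ isOdd i xor isOdd (k ∸ i)
      oddness {i} i≤k = trans (cong isOdd (sym (m+[n∸m]≡n i≤k))) (isOdd-+ i (k ∸ i))

  logD-twist : ∀ {a l} → a HasLogDerivative l → twist a HasLogDerivative twist l
  logD-twist {a} {l} al k = begin
    k ×R sign (isOdd k) (a k)          ≡⟨ sign-× (isOdd k) k (a k) ⟩
    sign (isOdd k) (k ×R a k)          ≡⟨ cong (sign (isOdd k)) (al k) ⟩
    sign (isOdd k) (mulS a l k)       ≡⟨ twist-mulS a l k ⟩
    mulS (twist a) (twist l) k        ∎

  split : ∀ σ → σ ≈S addS (evenS σ) (oddS σ)
  split σ k with isEven k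
  ... | true = sym (Rc.+-identityʳ (σ k))
  ... | false = sym (Rc.+-identityˡ (σ k))

  twist-split : ∀ σ → twist σ ≈S addS (evenS σ) (negS (oddS σ))
  twist-split σ k with isEven k
  ... | true = sym (trans (cong (σ k +R_) -0#≈0#) (Rc.+-identityʳ (σ k)))
  ... | false = sym (Rc.+-identityˡ (-R σ k))

  neg-^R : ∀ y k → (-R y) ^R k ≡ sign (isOdd k) (y ^R k)
  neg-^R y zero = refl
  neg-^R y (suc k) = begin
    (-R y) *R (-R y) ^R k                     ≡⟨ cong ((-R y) *R_) (neg-^R y k) ⟩
    sign true y *R sign (isOdd k) (y ^R k)    ≡⟨ sign-*R true (isOdd k) y (y ^R k) ⟩
    sign (not (isOdd k)) (y ^R suc k)         ≡⟨ cong (λ p → sign p (y ^R suc k)) (sym (isOdd-suc k)) ⟩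
    sign (isOdd (suc k)) (y ^R suc k)         ∎

  ^R≡^ : ∀ a k → a ^R k ≡ a ^ k
  ^R≡^ a zero = refl
  ^R≡^ a (suc k) = cong (a *R_) (^R≡^ a k)

  ^R-comm : ∀ a i k → (a ^R i) ^R k ≡ (a ^R k) ^R i
  ^R-comm a i k = begin
    (a ^R i) ^R k  ≡⟨ trans (^R≡^ (a ^R i) k) (cong (_^ k) (^R≡^ a i)) ⟩
    (a ^ i) ^ k    ≡⟨ ^-assocʳ a i k ⟩
    a ^ (i * k)    ≡⟨ cong (a ^_) (ℕₚ.*-comm i k) ⟩
    a ^ (k * i)    ≡⟨ sym (^-assocʳ a k i) ⟩
    (a ^ k) ^ i    ≡⟨ sym (trans (^R≡^ (a ^R k) i) (cong (_^ i) (^R≡^ a k))) ⟩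
    (a ^R k) ^R i  ∎

  digit-syndrome : ∀ α i c k → isOdd k ≡ true →
    (leeW c ×S geomLog (Xval α i c)) k ≡ -R ((α ^R k) ^R i *R embed c)
  digit-syndrome α i c zero ()
  digit-syndrome α i c (suc k) k-odd = trans (contribution c) (cong (-R_) (sym (trans (Rc.*-comm B (embed c)) (embed-*R c B))))
    where
      B = (α ^R suc k) ^R i
      αⁱ^k : (α ^R i) ^R suc k ≡ B
      αⁱ^k = ^R-comm α i (suc k)
      contribution : ∀ c → leeW c ×R geomLog (Xval α i c) (suc k) ≡ -R (c ⊙ B)
      contribution z0 = sym (trans (cong (-R_) (⊙-zeroˡ B)) -0#≈0#)
      contribution z1 = begin
        -R ((α ^R i) ^R suc k) +R 0R     ≡⟨ Rc.+-identityʳ _ ⟩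
        -R ((α ^R i) ^R suc k)           ≡⟨ cong (-R_) (trans αⁱ^k (sym (⊙-identity B))) ⟩
        -R (z1 ⊙ B)                      ∎
      contribution z2 = begin
        -R ((α ^R i) ^R suc k) +R (-R ((α ^R i) ^R suc k) +R 0R) ≡⟨ cong (λ w → -R w +R (-R w +R 0R)) αⁱ^k ⟩
        -R B +R (-R B +R 0R)                                     ≡⟨ cong (-R B +R_) (Rc.+-identityʳ _) ⟩
        -R B +R (-R B)                                           ≡⟨ -‿+-comm B B ⟩
        -R (B +R B)                                              ≡⟨ cong (-R_) (sym (z2⊙ B)) ⟩
        -R (z2 ⊙ B)                                              ∎
        where
          z2⊙ : ∀ {n} (v : Vec Z4 n) → z2 ⊙ v ≡ v ⊕ v
          z2⊙ [] = refl
          z2⊙ (x ∷ v) = cong₂ _∷_ (from-yes (all₄? λ a → z2 *₄ a ≟₄ a +₄ a) x) (z2⊙ v)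
      contribution z3 = begin
        -R ((-R (α ^R i)) ^R suc k) +R 0R           ≡⟨ Rc.+-identityʳ _ ⟩
        -R ((-R (α ^R i)) ^R suc k)                 ≡⟨ cong (-R_) (neg-^R (α ^R i) (suc k)) ⟩
        -R (sign (isOdd (suc k)) ((α ^R i) ^R suc k)) ≡⟨ cong (λ p → -R (sign p ((α ^R i) ^R suc k))) k-odd ⟩
        -R (-R ((α ^R i) ^R suc k))                 ≡⟨ cong (λ w → -R (-R w)) αⁱ^k ⟩
        -R (-R B)                                   ≡⟨ cong (-R_) (⊖≡z3⊙ B) ⟩
        -R (z3 ⊙ B)                                 ∎

  locatorLog-syndrome : ∀ α k → isOdd k ≡ true → ∀ i {n} (e : Vec Z4 n) →
    locatorLog α i e k ≡ -R ((α ^R k) ^R i *R evalAt e (α ^R k))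
  locatorLog-syndrome α k k-odd i [] = sym (trans (cong (-R_) (Rc.zeroʳ ((α ^R k) ^R i))) -0#≈0#)
  locatorLog-syndrome α k k-odd i (c ∷ cs) = begin
      (leeW c ×S geomLog (Xval α i c)) k +R locatorLog α (suc i) cs k
    ≡⟨ cong₂ _+R_ (digit-syndrome α i c k k-odd) (locatorLog-syndrome α k k-odd (suc i) cs) ⟩
      -R (B *R embed c) +R (-R ((β *R B) *R ev))
    ≡⟨ -‿+-comm _ _ ⟩
      -R (B *R embed c +R (β *R B) *R ev)
    ≡⟨ cong (λ w → -R (B *R embed c +R w)) (trans (cong (_*R ev) (Rc.*-comm β B)) (Rc.*-assoc B β ev)) ⟩
      -R (B *R embed c +R B *R (β *R ev))
    ≡⟨ cong (-R_) (sym (Rc.distribˡ B (embed c) (β *R ev))) ⟩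
      -R (B *R (embed c +R β *R ev)) ∎
    where
      β = α ^R k
      B = β ^R i
      ev = evalAt cs β

module Decoding (m : ℕ) (h : Vec Z4 m) where
  open GR m h
  open SeriesRing m h
  open Truncation m h
  open LogDerivative m h
  open WordDifference
  open RingIdentities Scr using (unit-solve; unit-cancel; twisted-product)
  open import Algebra.Properties.Ring Rc.ring using (-0#≈0#; -‿+-comm; -‿distribʳ-*; -‿injective; +-inverseʳ-unique)
  open ≡-Reasoning

  V W : Series → Series
  V σ = addS oneS (zS (uS σ))
  W σ = invS (V σ)

  uS-odd : ∀ N σ → ParityBelow true N (uS σ)
  uS-odd N σ = parity-mulS (parity-oddS σ) (parity-invS N (parity-evenS σ))

  W-even : ∀ N σ → ParityBelow false (suc N) (W σ)
  W-even N σ = parity-invS (suc N) (parity-addS parity-oneS (parity-zS (uS-odd N σ)))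

  -- T_1, …, T_t determine W below degree 2t + 1: its odd coefficients vanish.
  W-agree : ∀ t σ σ′ → (∀ k → 1 ≤ k → k ≤ t → Tcoef σ k ≡ Tcoef σ′ k) → Agree (suc (2 * t)) (W σ) (W σ′)
  W-agree t σ σ′ T≡ j j<1+2t with isOdd j in j-oddness
  ... | true = trans (W-even (2 * t) σ j j<1+2t (odd≢even j j-oddness))
                     (sym (W-even (2 * t) σ′ j j<1+2t (odd≢even j j-oddness)))
  ... | false with isOdd-false⇒double j j-oddness
  ...   | zero , refl = trans (invS-zero (V σ)) (sym (invS-zero (V σ′)))
  ...   | suc k , refl = T≡ (suc k) (s≤s z≤n) (ℕₚ.*-cancelˡ-≤ 2 (ℕ.s≤s⁻¹ j<1+2t))

  -- V is the inverse of W, so it is determined by W in the same degrees; so is u.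
  V-inverse : ∀ σ → V σ ≈S mulS (invS (W σ)) oneS
  V-inverse σ = unit-solve {W σ} {invS (W σ)} {V σ} {oneS}
    (invS-inverse (W σ) (invS-zero (V σ)))
    (λ k → trans (mulS-comm (W σ) (V σ) k) (invS-inverse (V σ) (Rc.+-identityʳ 1R) k))

  u-agree : ∀ N σ σ′ → Agree (suc N) (W σ) (W σ′) → Agree N (uS σ) (uS σ′)
  u-agree N σ σ′ WW k k<N = begin
      uS σ k         ≡⟨ sym (Rc.+-identityˡ (uS σ k)) ⟩
      V σ (suc k)    ≡⟨ VV (suc k) (s≤s k<N) ⟩
      V σ′ (suc k)   ≡⟨ Rc.+-identityˡ (uS σ′ k) ⟩
      uS σ′ k        ∎
    where
      VV : Agree (suc N) (V σ) (V σ′)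
      VV = agree-≈ (V-inverse σ) (V-inverse σ′)
             (agree-mulS {a = invS (W σ)} {invS (W σ′)} {oneS} {oneS} (agree-invS (suc N) WW) (λ _ _ → refl))

  -- If u and u′ agree below N, then σ(z) σ′(-z) is even below N: writing
  -- σ = E + O, σ′ = E′ + O′ with O = u E, O′ = u′ E′, it equals
  -- (E E′ - O O′) + (u - u′) E E′.
  twisted-even : ∀ N σ σ′ → σ 0 ≡ 1R → σ′ 0 ≡ 1R → Agree N (uS σ) (uS σ′) → ParityBelow false N (mulS σ (twist σ′))
  twisted-even N σ σ′ σ₀ σ′₀ uu = parity-agree (agree-≈ P≈ (λ _ → refl) (agree-cancel X uEE′)) X-even
    where
      E E′ O O′ EE′ X : Series
      E = evenS σ
      E′ = evenS σ′
      O = oddS σ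
      O′ = oddS σ′
      EE′ = mulS E E′
      X = addS EE′ (negS (mulS O O′))
      O≈uE : ∀ {τ} → τ 0 ≡ 1R → oddS τ ≈S mulS (uS τ) (evenS τ)
      O≈uE {τ} τ₀ k = sym (unit-cancel {evenS τ} {invS (evenS τ)} (oddS τ) (invS-inverse (evenS τ) τ₀) k)
      P≈ : mulS σ (twist σ′) ≈S addS X (addS (mulS (uS σ) EE′) (negS (mulS (uS σ′) EE′)))
      P≈ k = trans (mulS-cong {σ} {addS E O} {twist σ′} {addS E′ (negS O′)} (split σ) (twist-split σ′) k)
                   (twisted-product {E} {O} {E′} {O′} (uS σ) (uS σ′) (O≈uE σ₀) (O≈uE σ′₀) k)
      uEE′ : Agree N (mulS (uS σ) EE′) (mulS (uS σ′) EE′)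
      uEE′ = agree-mulS {a = uS σ} {uS σ′} {EE′} {EE′} uu (λ _ _ → refl)
      X-even : ParityBelow false N X
      X-even = parity-addS {a = EE′} (parity-mulS (parity-evenS σ) (parity-evenS σ′))
                 (parity-negS {a = mulS O O′} (parity-mulS (parity-oddS σ) (parity-oddS σ′)))

  -- The logarithmic derivative of a series that is even below N and has
  -- constant term 1 is even below N, being P′/P = P⁻¹ · D P.
  logD-even : ∀ N {P M} → P 0 ≡ 1R → P HasLogDerivative M → ParityBelow false N P → ParityBelow false N M
  logD-even N {P} {M} P₀ PM P-even =
    parity-agree M≈ (parity-mulS {a = invS P} {D P} (parity-invS N P-even) (parity-D {a = P} P-even))
    where
      M≈ : Agree N M (mulS (invS P) (D P))
      M≈ k _ = unit-solve {P} {invS P} {M} {D P} (invS-inverse P P₀) (λ k → sym (PM k)) k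

  isOdd-2j+1 : ∀ j → isOdd (suc (2 * j)) ≡ true
  isOdd-2j+1 j = trans (isOdd-suc (2 * j)) (cong not (begin
    isOdd (j + (j + 0))          ≡⟨ isOdd-+ j (j + 0) ⟩
    isOdd j xor isOdd (j + 0)    ≡⟨ cong (λ i → isOdd j xor isOdd i) (ℕₚ.+-identityʳ j) ⟩
    isOdd j xor isOdd j          ≡⟨ xor-same (isOdd j) ⟩
    false                        ∎))

  locator-syndrome : ∀ α k → isOdd k ≡ true → ∀ {n} (e : Vec Z4 n) →
    locatorLog α 0 e k ≡ -R evalAt e (α ^R k)
  locator-syndrome α k k-odd e =
    trans (locatorLog-syndrome α k k-odd 0 e) (cong (-R_) (Rc.*-identityˡ (evalAt e (α ^R k))))

  equal-syndromes : ∀ α t {n} (e e′ : Vec Z4 n) →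
    (∀ k → 1 ≤ k → k ≤ t → Tcoef (locator α e) k ≡ Tcoef (locator α e′) k) →
    ∀ j → j < t → evalAt e (α ^R (2 * j + 1)) ≡ evalAt e′ (α ^R (2 * j + 1))
  equal-syndromes α t e e′ T≡ j j<t
    rewrite ℕₚ.+-comm (2 * j) 1 = -‿injective (begin
      -R evalAt e (α ^R k)    ≡⟨ sym (locator-syndrome α k k-odd e) ⟩
      ℓ k                     ≡⟨ ℓ≡ℓ′ ⟩
      ℓ′ k                    ≡⟨ locator-syndrome α k k-odd e′ ⟩
      -R evalAt e′ (α ^R k)   ∎)
    where
      σ σ′ ℓ ℓ′ : Series
      σ = locator α e
      σ′ = locator α e′
      ℓ = locatorLog α 0 e
      ℓ′ = locatorLog α 0 e′
      k = suc (2 * j)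
      k-odd = isOdd-2j+1 j
      k<2t : k < 2 * t
      k<2t = ≤-trans (ℕₚ.≤-reflexive (sym (ℕₚ.*-suc 2 j))) (ℕₚ.*-monoʳ-≤ 2 j<t)
      σ₀ = locFrom-constant α 0 e
      σ′₀ = locFrom-constant α 0 e′
      P-even : ParityBelow false (2 * t) (mulS σ (twist σ′))
      P-even = twisted-even (2 * t) σ σ′ σ₀ σ′₀ (u-agree (2 * t) σ σ′ (W-agree t σ σ′ T≡))
      M-even : ParityBelow false (2 * t) (addS ℓ (twist ℓ′))
      M-even = logD-even (2 * t) (trans (cong₂ _*R_ σ₀ σ′₀) (Rc.*-identityˡ 1R))
                 (logD-mulS {σ} {twist σ′} {ℓ} {twist ℓ′} (logD-locFrom α 0 e) (logD-twist {σ′} {ℓ′} (logD-locFrom α 0 e′)))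
                 P-even
      ℓ≡ℓ′ : ℓ k ≡ ℓ′ k
      ℓ≡ℓ′ = -‿injective (sym (+-inverseʳ-unique (ℓ k) (-R ℓ′ k)
               (trans (cong (λ p → ℓ k +R sign p (ℓ′ k)) (sym k-odd))
                      (M-even k k<2t (odd≢even k k-odd)))))

  embed-⊖ : ∀ {k} a b → embed {k} (a +₄ (-₄ b)) ≡ embed a ⊕ map -₄_ (embed b)
  embed-⊖ {zero} a b = refl
  embed-⊖ {suc k} a b = cong ((a +₄ (-₄ b)) ∷_) (sym (⊕-inverseʳ 𝟘))

  evalAt-⊖ : ∀ {n} (e e′ : Vec Z4 n) x → evalAt (e ⊖ e′) x ≡ evalAt e x +R (-R evalAt e′ x)
  evalAt-⊖ [] [] x = sym (trans (cong (0R +R_) -0#≈0#) (Rc.+-identityʳ 0R))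
  evalAt-⊖ (a ∷ e) (b ∷ e′) x = begin
      embed (a +₄ (-₄ b)) +R x *R evalAt (e ⊖ e′) x
    ≡⟨ cong₂ (λ c v → c +R x *R v) (embed-⊖ a b) (evalAt-⊖ e e′ x) ⟩
      (embed a +R (-R embed b)) +R x *R (evalAt e x +R (-R evalAt e′ x))
    ≡⟨ cong ((embed a +R (-R embed b)) +R_)
            (trans (Rc.distribˡ x _ _) (cong (x *R evalAt e x +R_) (sym (-‿distribʳ-* x (evalAt e′ x))))) ⟩
      (embed a +R (-R embed b)) +R (x *R evalAt e x +R (-R (x *R evalAt e′ x)))
    ≡⟨ ⊕-interchange (embed a) (-R embed b) _ _ ⟩
      (embed a +R x *R evalAt e x) +R ((-R embed b) +R (-R (x *R evalAt e′ x)))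
    ≡⟨ cong ((embed a +R x *R evalAt e x) +R_) (-‿+-comm (embed b) (x *R evalAt e′ x)) ⟩
      (embed a +R x *R evalAt e x) +R (-R (embed b +R x *R evalAt e′ x)) ∎

  -- The main result: errors of Lee weight ≤ r with the same T_1, …, T_t
  -- coincide, since their difference is a codeword of Lee weight ≤ 2r.
  unique-error : ∀ n α t r →
    (∀ (c : Vec Z4 n) → (∀ j → j < t → evalAt c (α ^R (2 * j + 1)) ≡ 0R) →
       c ≢ replicate n z0 → 2 * r + 1 ≤ leeWeight c) →
    (e e′ : Vec Z4 n) → leeWeight e ≤ r → leeWeight e′ ≤ r →
    (∀ k → 1 ≤ k → k ≤ t → Tcoef (locator α e) k ≡ Tcoef (locator α e′) k) →
    e ≡ e′
  unique-error n α t r code e e′ we we′ T≡ with ≡-dec _≟₄_ e e′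
  ... | yes e≡e′ = e≡e′
  ... | no e≢e′ = ⊥-elim (ℕₚ.m+1+n≰m (2 * r) (≤-trans (code (e ⊖ e′) codeword (λ d≡0 → e≢e′ (⊖-zero e e′ d≡0))) weight))
    where
      codeword : ∀ j → j < t → evalAt (e ⊖ e′) (α ^R (2 * j + 1)) ≡ 0R
      codeword j j<t = trans (evalAt-⊖ e e′ _)
        (trans (cong (_+R (-R evalAt e′ _)) (equal-syndromes α t e e′ T≡ j j<t)) (Rc.-‿inverseʳ _))
      weight : leeWeight (e ⊖ e′) ≤ 2 * r
      weight = ≤-trans (leeWeight-⊖ e e′)
                 (≤-trans (ℕₚ.+-mono-≤ we we′) (ℕₚ.≤-reflexive (cong (r +_) (sym (ℕₚ.+-identityʳ r)))))

lemma4p1 : (m : ℕ) (h : Vec Z4 m) → BasicIrreducible m h →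
    let open GR m h in
    (n : ℕ) → n % 2 ≡ 1 →
    (α : R) → α ^R (2 * n) ≡ 1R → (∀ k → 0 < k → k < 2 * n → α ^R k ≢ 1R) →
    α ^R n ≡ -R 1R →
    (t r : ℕ) → 1 ≤ t → 1 ≤ r →
    (∀ (c : Vec Z4 n) → (∀ j → j < t → evalAt c (α ^R (2 * j + 1)) ≡ 0R) →
       c ≢ replicate n z0 → 2 * r + 1 ≤ leeWeight c) →
    (e e′ : Vec Z4 n) → leeWeight e ≤ r → leeWeight e′ ≤ r →
    (∀ k → 1 ≤ k → k ≤ t → Tcoef (locator α e) k ≡ Tcoef (locator α e′) k) →
    ∀ i → locator α e i ≡ locator α e′ i
lemma4p1 m h _ n _ α _ _ _ t r _ _ code e e′ we we′ T≡ i =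
  cong (λ v → GR.locator m h α v i) (Decoding.unique-error m h n α t r code e e′ we we′ T≡)
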